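{- Let $G=(V,E)$ be a finite connected undirected graph, $q\in V$, and $\sigma$ a total ordering of $E$. If $T_1$ and $T_2$ are distinct spanning trees of $G$ that are both safe with respect to $\sigma$, then $\mu(T_1)\neq\mu(T_2)$.
   Context: An edge $e$ is larger than $f$ if $\sigma(e)>\sigma(f)$. A spanning tree $T$ is safe with respect to $\sigma$ if for every edge $e\notin T$, the unique cycle in $T+e$ contains an edge larger than $e$. Given a spanning tree $T$, for a vertex $i$ let $P_i$ be the unique path in $T$ from $i$ to $q$. For vertices $i,j$, let $meet(i,j)$ be the first vertex of $P_i$ lying on $P_j$ (so if $j$ lies on $P_i$ then $meet(i,j)=j$). Let $e_{ij}$ be the largest edge (under $\sigma$) on the subpath of $P_i$ from $i$ to $meet(i,j)$, and $e_{ij}$ is the null edge if $i=meet(i,j)$; the null edge is considered smaller than every edge. Write $i\succ j$ if $e_{ij}$ is larger than $e_{ji}$. The orientation $\mu(T)$ of $G$ is obtained by orienting every edge $\{i,j\}$ of $G$ from $i$ to $j$ if $i\succ j$ and from $j$ to $i$ if $j\succ i$. -}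

module Defs where

open import Data.Nat using (ℕ; _<_; _≤_; _<?_)
open import Data.Fin using (Fin; _≟_)
open import Data.Fin.Subset using (Subset; _∈_; _∉_; _∪_; ⁅_⁆; ⊤)
open import Data.List using (List; []; _∷_; length)
open import Data.List.Relation.Unary.Unique.Propositional using (Unique)
open import Data.List.Relation.Unary.Any using (Any; any?)
open import Data.Maybe using (Maybe; just; nothing)
open import Data.Product using (Σ; _×_; _,_)
open import Data.Sum using (_⊎_)
open import Data.Empty using (⊥)
open import Data.Unit using () renaming (⊤ to 𝟙)
open import Relation.Nullary using (¬_; yes; no)
open import Relation.Binary.PropositionalEquality using (_≡_; _≢_)
open import Function.Bundles using (_⇔_)

-- A finite simple undirected graph: vertices Fin n, edges Fin m,
-- edge e has endpoints src e and tgt e (the order of the endpoints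
-- carries no meaning).  No loops, no parallel edges.
record Graph : Set where
  field
    n : ℕ
    m : ℕ
    src : Fin m → Fin n
    tgt : Fin m → Fin n
    loopless : ∀ e → src e ≢ tgt e
    noParallel₁ : ∀ e f → src e ≡ src f → tgt e ≡ tgt f → e ≡ f
    noParallel₂ : ∀ e f → src e ≡ tgt f → tgt e ≡ src f → e ≡ f

module _ (G : Graph) where
  open Graph G

  Joins : Fin m → Fin n → Fin n → Set
  Joins e x y = (src e ≡ x × tgt e ≡ y) ⊎ (src e ≡ y × tgt e ≡ x)

  data Walk (S : Subset m) : Fin n → Fin n → Set where
    [] : ∀ {x} → Walk S x x
    step : ∀ {x y z} (e : Fin m) → e ∈ S → Joins e x y → Walk S y z → Walk S x z

  vertices : ∀ {S x y} → Walk S x y → List (Fin n)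
  vertices {x = x} [] = x ∷ []
  vertices {x = x} (step e _ _ w) = x ∷ vertices w

  edges : ∀ {S x y} → Walk S x y → List (Fin m)
  edges [] = []
  edges (step e _ _ w) = e ∷ edges w

  IsPath : ∀ {S x y} → Walk S x y → Set
  IsPath w = Unique (vertices w)

  IsCycle : ∀ {S x} → Walk S x x → Set
  IsCycle [] = ⊥
  IsCycle (step e _ _ w) = 3 ≤ length (edges w) Data.Nat.+ 1 × Unique (vertices w)

  Connected : Set
  Connected = ∀ x y → Walk ⊤ x y

  IsSpanningTree : Subset m → Set
  IsSpanningTree T = (∀ x y → Walk T x y) × (∀ x (w : Walk T x x) → ¬ IsCycle w)

  -- σ : a total ordering of E, given as an injective ranking; f larger than e iff σ e < σ f
  module _ (σ : Fin m → ℕ) where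

    Safe : Subset m → Set
    Safe T = ∀ e → e ∉ T → ∀ x (w : Walk (T ∪ ⁅ e ⁆) x x) → IsCycle w →
             Any (λ f → σ e < σ f) (edges w)

    -- largest edge of a list under σ; nothing = the null edge
    largest : List (Fin m) → Maybe (Fin m)
    largest [] = nothing
    largest (e ∷ es) with largest es
    ... | nothing = just e
    ... | just f with σ f <? σ e
    ... | yes _ = just e
    ... | no _ = just f

    Larger : Maybe (Fin m) → Maybe (Fin m) → Set
    Larger nothing _ = ⊥
    Larger (just e) nothing = 𝟙
    Larger (just e) (just f) = σ f < σ e

    prefixEdges : ∀ {S x y} → List (Fin n) → Walk S x y → List (Fin m)
    prefixEdges L [] = []
    prefixEdges {x = x} L (step e _ _ w) with any? (x ≟_) L
    ... | yes _ = []
    ... | no _ = e ∷ prefixEdges L w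

    module _ (q : Fin n) (T : Subset m) where

      -- i ≻ j : with P_i, P_j the paths in T from i, j to q,
      -- e_ij = largest edge of P_i from i to meet(i,j) is larger than e_ji
      Succ : Fin n → Fin n → Set
      Succ i j = Σ (Walk T i q) λ Pi → Σ (Walk T j q) λ Pj → IsPath Pi × IsPath Pj ×
        Larger (largest (prefixEdges (vertices Pj) Pi)) (largest (prefixEdges (vertices Pi) Pj))

      -- μ(T) as a directed graph: μ T i j  iff  μ(T) contains an edge oriented from i to j
      μ : Fin n → Fin n → Set
      μ i j = Σ (Fin m) λ e → Joins e i j × Succ i j

  SameOrientation : (Fin n → Fin n → Set) → (Fin n → Fin n → Set) → Set
  SameOrientation o₁ o₂ = ∀ i j → o₁ i j ⇔ o₂ i j

-- Write P_x for the path from x to q in a spanning tree; i ≻ j says that some edge of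
-- P_i ∖ P_j beats all of P_j ∖ P_i, so in particular a vertex dominates its parent.
-- Given two safe trees inducing the same orientation, show by downward induction on σ
-- that each edge h lies on the same paths P_x in both trees. Walk along P_x in the first
-- tree: its first edge g, from x to p, makes x ≻ p, hence x ≻ p in the second tree as
-- well; safety of the second tree provides an edge at least as large as g separating x
-- from p there, and agreement on the edges above h forces h onto the second tree's P_x
-- too. As every tree edge lies on some P_x, the two trees coincide.
module Submission where

open import Defs
open import Data.Empty using (⊥-elim)
open import Data.Fin using (Fin; _≟_)
open import Data.Fin.Subset using (Subset; _∈_; _∉_; ⁅_⁆; _⊆_)
open import Data.Fin.Subset.Properties using (_∈?_; p⊆p∪q; x∈p∪q⁺; x∈⁅x⁆; ⊆-antisym)
open import Data.List using (List; []; _∷_; _++_; map; allFin)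
open import Data.List.Extrema.Nat using (max; xs≤max)
open import Data.List.Membership.Propositional using (find; lose) renaming (_∈_ to _∈ₗ_; _∉_ to _∉ₗ_)
open import Data.List.Membership.Propositional.Properties using (∈-++⁻; ∈-++⁺ˡ; ∈-++⁺ʳ; ∈-map⁺; ∈-allFin)
open import Data.List.Relation.Unary.All using ([]; lookup)
open import Data.List.Relation.Unary.All.Properties using (¬Any⇒All¬; All¬⇒¬Any)
open import Data.List.Relation.Unary.AllPairs using ([]; _∷_) renaming (tail to unique-tail)
open import Data.List.Relation.Unary.Any using (Any; here; there; any?)
open import Data.List.Relation.Unary.Unique.Propositional using (Unique)
open import Data.Maybe using (Maybe; just; nothing)
open import Data.Nat using (ℕ; _≤_; _<_; _∸_; s≤s; _<?_)
open import Data.Nat.Induction using (<-wellFounded)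
open import Data.Nat.Properties using (≤-refl; ≤-trans; <⇒≤; ≮⇒≥; ≤-<-trans; <-≤-trans; <-irrefl; m≤n+m; m≤n⇒m<n∨m≡n; ∸-monoʳ-<)
open import Data.Product using (Σ; _×_; _,_; proj₁; proj₂; swap)
open import Data.Sum using (_⊎_; inj₁; inj₂)
open import Data.Unit using (tt)
open import Function.Bundles using (Equivalence)
open import Function.Definitions using (Injective)
open import Induction.WellFounded using (module All)
open import Relation.Binary.Construct.On using () renaming (wellFounded to on-wellFounded)
open import Relation.Binary.PropositionalEquality using (_≡_; _≢_; refl; sym; trans; cong; subst)
open import Relation.Nullary using (¬_; yes; no)

downward-induction : ∀ {m} (f : Fin m → ℕ) (P : Fin m → Set) →
  (∀ x → (∀ {y} → f x < f y → P y) → P x) → ∀ x → P x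
downward-induction {m} f P larger-first =
  All.wfRec (on-wellFounded gap <-wellFounded) _ P
    λ x rec → larger-first x λ fx<fy → rec (∸-monoʳ-< fx<fy (bounded _))
  where
  bound : ℕ
  bound = max 0 (map f (allFin m))
  bounded : ∀ x → f x ≤ bound
  bounded x = lookup (xs≤max 0 (map f (allFin m))) (∈-map⁺ f (∈-allFin x))
  gap : Fin m → ℕ
  gap x = bound ∸ f x

module Walks (G : Graph) where
  open Graph G

  private variable
    S S′ : Subset m
    e f : Fin m
    i j k v x y z : Fin n
    xs : List (Fin n)

  Joins-sym : Joins G e x y → Joins G e y x
  Joins-sym (inj₁ p) = inj₂ p
  Joins-sym (inj₂ p) = inj₁ p

  Joins-irrefl : ¬ Joins G e x x
  Joins-irrefl (inj₁ (s , t)) = loopless _ (trans s (sym t))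
  Joins-irrefl (inj₂ (s , t)) = loopless _ (trans s (sym t))

  Joins-injective : Joins G e x y → Joins G f x y → e ≡ f
  Joins-injective (inj₁ (s , t)) (inj₁ (s' , t')) = noParallel₁ _ _ (trans s (sym s')) (trans t (sym t'))
  Joins-injective (inj₁ (s , t)) (inj₂ (s' , t')) = noParallel₂ _ _ (trans s (sym t')) (trans t (sym s'))
  Joins-injective (inj₂ (s , t)) (inj₁ (s' , t')) = noParallel₂ _ _ (trans s (sym t')) (trans t (sym s'))
  Joins-injective (inj₂ (s , t)) (inj₂ (s' , t')) = noParallel₁ _ _ (trans s (sym s')) (trans t (sym t'))

  Joins-functional : Joins G e x y → Joins G e x z → y ≡ z
  Joins-functional (inj₁ (_ , t)) (inj₁ (_ , t')) = trans (sym t) t'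
  Joins-functional (inj₁ (s , _)) (inj₂ (_ , t')) = ⊥-elim (loopless _ (trans s (sym t')))
  Joins-functional (inj₂ (_ , t)) (inj₁ (s' , _)) = ⊥-elim (loopless _ (trans s' (sym t)))
  Joins-functional (inj₂ (s , _)) (inj₂ (s' , _)) = trans (sym s) s'

  Joins-start : Joins G e x y → x ≡ src e ⊎ x ≡ tgt e
  Joins-start (inj₁ (s , _)) = inj₁ (sym s)
  Joins-start (inj₂ (_ , t)) = inj₂ (sym t)

  head∉ : Unique (x ∷ xs) → x ∉ₗ xs
  head∉ (x∉ ∷ _) = All¬⇒¬Any x∉

  _∷ᵘ_ : x ∉ₗ xs → Unique xs → Unique (x ∷ xs)
  _∷ᵘ_ {xs = xs} x∉ u = ¬Any⇒All¬ xs x∉ ∷ u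

  infixr 5 _++ʷ_
  _++ʷ_ : Walk G S x y → Walk G S y z → Walk G S x z
  [] ++ʷ B = B
  step e p jn A ++ʷ B = step e p jn (A ++ʷ B)

  reverse : Walk G S x y → Walk G S y x
  reverse [] = []
  reverse (step e p jn w) = reverse w ++ʷ step e p (Joins-sym jn) []

  weaken : S ⊆ S′ → Walk G S x y → Walk G S′ x y
  weaken S⊆S′ [] = []
  weaken S⊆S′ (step e p jn w) = step e (S⊆S′ p) jn (weaken S⊆S′ w)

  start∈ : (w : Walk G S x y) → x ∈ₗ vertices G w
  start∈ [] = here refl
  start∈ (step _ _ _ _) = here refl

  end∈ : (w : Walk G S x y) → y ∈ₗ vertices G w
  end∈ [] = here refl
  end∈ (step _ _ _ w) = there (end∈ w)

  edges-++ʷ : (A : Walk G S x y) (B : Walk G S y z) → edges G (A ++ʷ B) ≡ edges G A ++ edges G B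
  edges-++ʷ [] B = refl
  edges-++ʷ (step e _ _ A) B = cong (e ∷_) (edges-++ʷ A B)

  ∈-edges-++ʷ⁻ : (A : Walk G S x y) (B : Walk G S y z) → f ∈ₗ edges G (A ++ʷ B) →
    f ∈ₗ edges G A ⊎ f ∈ₗ edges G B
  ∈-edges-++ʷ⁻ A B f∈ = ∈-++⁻ (edges G A) (subst (_ ∈ₗ_) (edges-++ʷ A B) f∈)

  ∈-edges-++ʷˡ : (A : Walk G S x y) (B : Walk G S y z) → f ∈ₗ edges G A → f ∈ₗ edges G (A ++ʷ B)
  ∈-edges-++ʷˡ A B f∈ = subst (_ ∈ₗ_) (sym (edges-++ʷ A B)) (∈-++⁺ˡ f∈)

  ∈-edges-++ʷʳ : (A : Walk G S x y) (B : Walk G S y z) → f ∈ₗ edges G B → f ∈ₗ edges G (A ++ʷ B)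
  ∈-edges-++ʷʳ A B f∈ = subst (_ ∈ₗ_) (sym (edges-++ʷ A B)) (∈-++⁺ʳ (edges G A) f∈)

  ∈-vertices-++ʷ⁻ : (A : Walk G S x y) (B : Walk G S y z) → v ∈ₗ vertices G (A ++ʷ B) →
    v ∈ₗ vertices G A ⊎ v ∈ₗ vertices G B
  ∈-vertices-++ʷ⁻ [] B v∈ = inj₂ v∈
  ∈-vertices-++ʷ⁻ (step _ _ _ A) B (here refl) = inj₁ (here refl)
  ∈-vertices-++ʷ⁻ (step _ _ _ A) B (there v∈) with ∈-vertices-++ʷ⁻ A B v∈
  ... | inj₁ v∈A = inj₁ (there v∈A)
  ... | inj₂ v∈B = inj₂ v∈B

  ∈-vertices-++ʷˡ : (A : Walk G S x y) (B : Walk G S y z) → v ∈ₗ vertices G A →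
    v ∈ₗ vertices G (A ++ʷ B)
  ∈-vertices-++ʷˡ [] B (here refl) = start∈ B
  ∈-vertices-++ʷˡ (step _ _ _ A) B (here refl) = here refl
  ∈-vertices-++ʷˡ (step _ _ _ A) B (there v∈) = there (∈-vertices-++ʷˡ A B v∈)

  ∈-vertices-++ʷʳ : (A : Walk G S x y) (B : Walk G S y z) → v ∈ₗ vertices G B →
    v ∈ₗ vertices G (A ++ʷ B)
  ∈-vertices-++ʷʳ [] B v∈ = v∈
  ∈-vertices-++ʷʳ (step _ _ _ A) B v∈ = there (∈-vertices-++ʷʳ A B v∈)

  ∈-edges-reverse⁻ : (w : Walk G S x y) → f ∈ₗ edges G (reverse w) → f ∈ₗ edges G w
  ∈-edges-reverse⁻ (step e p jn w) f∈ with ∈-edges-++ʷ⁻ (reverse w) (step e p (Joins-sym jn) []) f∈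
  ... | inj₁ f∈w = there (∈-edges-reverse⁻ w f∈w)
  ... | inj₂ (here refl) = here refl

  ∈-vertices-reverse⁻ : (w : Walk G S x y) → v ∈ₗ vertices G (reverse w) → v ∈ₗ vertices G w
  ∈-vertices-reverse⁻ [] v∈ = v∈
  ∈-vertices-reverse⁻ (step e p jn w) v∈ with ∈-vertices-++ʷ⁻ (reverse w) (step e p (Joins-sym jn) []) v∈
  ... | inj₁ v∈w = there (∈-vertices-reverse⁻ w v∈w)
  ... | inj₂ (here refl) = there (start∈ w)
  ... | inj₂ (there (here refl)) = here refl

  edges-weaken : (S⊆S′ : S ⊆ S′) (w : Walk G S x y) → edges G (weaken S⊆S′ w) ≡ edges G w
  edges-weaken S⊆S′ [] = refl
  edges-weaken S⊆S′ (step e _ _ w) = cong (e ∷_) (edges-weaken S⊆S′ w)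

  vertices-weaken : (S⊆S′ : S ⊆ S′) (w : Walk G S x y) → vertices G (weaken S⊆S′ w) ≡ vertices G w
  vertices-weaken S⊆S′ [] = refl
  vertices-weaken {x = x} S⊆S′ (step _ _ _ w) = cong (x ∷_) (vertices-weaken S⊆S′ w)

  ∈-edges⇒∈ : (w : Walk G S x y) → f ∈ₗ edges G w → f ∈ S
  ∈-edges⇒∈ (step _ p _ _) (here refl) = p
  ∈-edges⇒∈ (step _ _ _ w) (there f∈) = ∈-edges⇒∈ w f∈

  endpoints∈ : (w : Walk G S x y) → f ∈ₗ edges G w → src f ∈ₗ vertices G w × tgt f ∈ₗ vertices G w
  endpoints∈ (step _ _ (inj₁ (s , t)) w) (here refl) =
    here s , there (subst (_∈ₗ vertices G w) (sym t) (start∈ w))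
  endpoints∈ (step _ _ (inj₂ (s , t)) w) (here refl) =
    there (subst (_∈ₗ vertices G w) (sym s) (start∈ w)) , here t
  endpoints∈ (step _ _ _ w) (there f∈) with endpoints∈ w f∈
  ... | s∈ , t∈ = there s∈ , there t∈

  endpoint∉⇒∉edges : (w : Walk G S x y) → src f ∉ₗ vertices G w ⊎ tgt f ∉ₗ vertices G w →
    f ∉ₗ edges G w
  endpoint∉⇒∉edges w (inj₁ s∉) f∈ = s∉ (proj₁ (endpoints∈ w f∈))
  endpoint∉⇒∉edges w (inj₂ t∉) f∈ = t∉ (proj₂ (endpoints∈ w f∈))

  Joins-∉edges : Joins G e x y → (w : Walk G S z v) → x ∉ₗ vertices G w → e ∉ₗ edges G w
  Joins-∉edges jn w x∉ with Joins-start jn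
  ... | inj₁ refl = endpoint∉⇒∉edges w (inj₁ x∉)
  ... | inj₂ refl = endpoint∉⇒∉edges w (inj₂ x∉)

  path-++ʷ⁺ : (A : Walk G S x y) (B : Walk G S y z) → IsPath G A → IsPath G B →
    (∀ {v} → v ∈ₗ vertices G A → v ∈ₗ vertices G B → v ≡ y) → IsPath G (A ++ʷ B)
  path-++ʷ⁺ [] B _ pB _ = pB
  path-++ʷ⁺ {x = x} (step e p jn A) B pA pB junction =
    x∉ ∷ᵘ path-++ʷ⁺ A B (unique-tail pA) pB (λ v∈A → junction (there v∈A))
    where
    x∉ : x ∉ₗ vertices G (A ++ʷ B)
    x∉ x∈ with ∈-vertices-++ʷ⁻ A B x∈
    ... | inj₁ x∈A = head∉ pA x∈A
    ... | inj₂ x∈B with junction (here refl) x∈B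
    ... | refl = head∉ pA (end∈ A)

  path-++ʷ⁻ : (A : Walk G S x y) (B : Walk G S y z) → IsPath G (A ++ʷ B) →
    IsPath G A × IsPath G B × (∀ {v} → v ∈ₗ vertices G A → v ∈ₗ vertices G B → v ≡ y)
  path-++ʷ⁻ [] B pB = ([] ∷ []) , pB , λ { (here refl) _ → refl }
  path-++ʷ⁻ {y = y} (step e p jn A) B pAB with path-++ʷ⁻ A B (unique-tail pAB)
  ... | pA , pB , junction = (λ x∈A → head∉ pAB (∈-vertices-++ʷˡ A B x∈A)) ∷ᵘ pA , pB , junction′
    where
    junction′ : ∀ {v} → v ∈ₗ vertices G (step e p jn A) → v ∈ₗ vertices G B → v ≡ y
    junction′ (here refl) v∈B = ⊥-elim (head∉ pAB (∈-vertices-++ʷʳ A B v∈B))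
    junction′ (there v∈A) v∈B = junction v∈A v∈B

  prefix-path : (A : Walk G S x y) (B : Walk G S y z) → IsPath G (A ++ʷ B) → IsPath G A
  prefix-path A B pAB = proj₁ (path-++ʷ⁻ A B pAB)

  suffix-path : (A : Walk G S x y) (B : Walk G S y z) → IsPath G (A ++ʷ B) → IsPath G B
  suffix-path A B pAB = proj₁ (proj₂ (path-++ʷ⁻ A B pAB))

  path-edges-disjoint : (A : Walk G S x y) (B : Walk G S y z) → IsPath G (A ++ʷ B) →
    f ∈ₗ edges G A → f ∉ₗ edges G B
  path-edges-disjoint A B pAB f∈A f∈B with path-++ʷ⁻ A B pAB | endpoints∈ A f∈A | endpoints∈ B f∈B
  ... | _ , _ , junction | s∈A , t∈A | s∈B , t∈B =
    loopless _ (trans (junction s∈A s∈B) (sym (junction t∈A t∈B)))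

  reverse-path : (w : Walk G S x y) → IsPath G w → IsPath G (reverse w)
  reverse-path [] pw = pw
  reverse-path {x = x} (step {y = y} e p jn w) pw =
    path-++ʷ⁺ (reverse w) (step e p (Joins-sym jn) []) (reverse-path w (unique-tail pw)) edge-path junction
    where
    edge-path : IsPath G (step e p (Joins-sym jn) [])
    edge-path = (λ { (here refl) → Joins-irrefl jn }) ∷ᵘ ([] ∷ [])
    junction : ∀ {v} → v ∈ₗ vertices G (reverse w) → v ∈ₗ (y ∷ x ∷ []) → v ≡ y
    junction _ (here refl) = refl
    junction v∈ (there (here refl)) = ⊥-elim (head∉ pw (∈-vertices-reverse⁻ w v∈))

  cut : (w : Walk G S x y) → v ∈ₗ vertices G w →
    Σ (Walk G S x v) λ A → Σ (Walk G S v y) λ B → A ++ʷ B ≡ w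
  cut [] (here refl) = [] , [] , refl
  cut (step e p jn w) (here refl) = [] , step e p jn w , refl
  cut (step e p jn w) (there v∈) with cut w v∈
  ... | A , B , refl = step e p jn A , B , refl

  loop-erase : Walk G S x y → Σ (Walk G S x y) (IsPath G)
  loop-erase [] = [] , ([] ∷ [])
  loop-erase {x = x} (step e p jn w) with loop-erase w
  ... | w′ , pw′ with any? (x ≟_) (vertices G w′)
  ... | no x∉ = step e p jn w′ , x∉ ∷ᵘ pw′
  ... | yes x∈ with cut w′ x∈
  ... | A , B , refl = B , suffix-path A B pw′

  close-cycle : (p : e ∈ S) (jn : Joins G e x y) (w : Walk G S y x) → IsPath G w → e ∉ₗ edges G w →
    IsCycle G (step e p jn w)
  close-cycle p jn [] _ _ = ⊥-elim (Joins-irrefl jn)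
  close-cycle p jn (step f _ jf []) _ e∉ = ⊥-elim (e∉ (here (Joins-injective jn (Joins-sym jf))))
  close-cycle p jn (step _ _ _ (step _ _ _ _)) pw _ = s≤s (s≤s (m≤n+m 1 _)) , pw

  data FirstIn (L : List (Fin n)) : Walk G S x y → Set where
    first-in : (pre : Walk G S x k) (suf : Walk G S k y) → k ∈ₗ L →
               (∀ {v} → v ∈ₗ vertices G pre → v ∈ₗ L → v ≡ k) → FirstIn L (pre ++ʷ suf)

  firstIn : (L : List (Fin n)) (w : Walk G S x y) → Any (_∈ₗ L) (vertices G w) → FirstIn L w
  firstIn {x = x} L w hit with any? (x ≟_) L
  ... | yes x∈L = first-in [] w x∈L λ { (here refl) _ → refl }
  firstIn L [] (here y∈L) | no x∉L = ⊥-elim (x∉L y∈L)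
  firstIn L (step e p jn w) (here x∈L) | no x∉L = ⊥-elim (x∉L x∈L)
  firstIn L (step e p jn w) (there hit) | no x∉L with firstIn L w hit
  ... | first-in pre suf k∈L only-k = first-in (step e p jn pre) suf k∈L λ
    { (here refl) v∈L → ⊥-elim (x∉L v∈L)
    ; (there v∈pre) v∈L → only-k v∈pre v∈L }

  -- The common end of X₁ and Y₁ is meet(i, j), the first vertex of X lying on Y.
  data Meeting : Walk G S i y → Walk G S j y → Set where
    meeting : (X₁ : Walk G S i k) (X₂ : Walk G S k y) (Y₁ : Walk G S j k) (Y₂ : Walk G S k y) →
              (∀ {f} → f ∈ₗ edges G X₁ → f ∉ₗ edges G (Y₁ ++ʷ Y₂)) →
              IsPath G (Y₁ ++ʷ reverse X₁) → Meeting (X₁ ++ʷ X₂) (Y₁ ++ʷ Y₂)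

  meet : (X : Walk G S i y) (Y : Walk G S j y) → IsPath G X → IsPath G Y → Meeting X Y
  meet X Y pX pY with firstIn (vertices G Y) X (lose (end∈ X) (end∈ Y))
  ... | first-in X₁ X₂ k∈Y X₁-only-k with firstIn (vertices G X₁) Y (lose k∈Y (end∈ X₁))
  ... | first-in Y₁ Y₂ k′∈X₁ Y₁-only-k′ with X₁-only-k k′∈X₁ (∈-vertices-++ʷˡ Y₁ Y₂ (end∈ Y₁))
  ... | refl = meeting X₁ X₂ Y₁ Y₂ X₁-avoids-Y detour-path
    where
    X₁-avoids-Y : ∀ {f} → f ∈ₗ edges G X₁ → f ∉ₗ edges G (Y₁ ++ʷ Y₂)
    X₁-avoids-Y f∈X₁ f∈Y with endpoints∈ X₁ f∈X₁ | endpoints∈ (Y₁ ++ʷ Y₂) f∈Y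
    ... | s∈X₁ , t∈X₁ | s∈Y , t∈Y =
      loopless _ (trans (X₁-only-k s∈X₁ s∈Y) (sym (X₁-only-k t∈X₁ t∈Y)))
    detour-path : IsPath G (Y₁ ++ʷ reverse X₁)
    detour-path = path-++ʷ⁺ Y₁ (reverse X₁)
      (prefix-path Y₁ Y₂ pY) (reverse-path X₁ (prefix-path X₁ X₂ pX))
      λ v∈Y₁ v∈X₁ → Y₁-only-k′ v∈Y₁ (∈-vertices-reverse⁻ X₁ v∈X₁)

  detour : {X : Walk G S i y} {Y : Walk G S j y} → Meeting X Y → Walk G S j i
  detour (meeting X₁ _ Y₁ _ _ _) = Y₁ ++ʷ reverse X₁

  detour-path : {X : Walk G S i y} {Y : Walk G S j y} (M : Meeting X Y) → IsPath G (detour M)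
  detour-path (meeting _ _ _ _ _ p) = p

  detour-edges : {X : Walk G S i y} {Y : Walk G S j y} (M : Meeting X Y) →
    f ∈ₗ edges G (detour M) → f ∈ₗ edges G X ⊎ f ∈ₗ edges G Y
  detour-edges (meeting X₁ X₂ Y₁ Y₂ _ _) f∈ with ∈-edges-++ʷ⁻ Y₁ (reverse X₁) f∈
  ... | inj₁ f∈Y₁ = inj₂ (∈-edges-++ʷˡ Y₁ Y₂ f∈Y₁)
  ... | inj₂ f∈X₁ = inj₁ (∈-edges-++ʷˡ X₁ X₂ (∈-edges-reverse⁻ X₁ f∈X₁))

module Ranking (G : Graph) (σ : Fin (Graph.m G) → ℕ) where
  open Graph G
  open Walks G

  private variable
    S : Subset m
    f : Fin m
    x y : Fin n

  data Largest : List (Fin m) → Maybe (Fin m) → Set where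
    none : Largest [] nothing
    some : ∀ {l a} → a ∈ₗ l → (∀ {b} → b ∈ₗ l → σ b ≤ σ a) → Largest l (just a)

  largest-correct : ∀ l → Largest l (largest G σ l)
  largest-correct [] = none
  largest-correct (e ∷ es) with largest G σ es | largest-correct es
  ... | nothing | none = some (here refl) λ { (here refl) → ≤-refl }
  ... | just a | some a∈ a-max with σ a <? σ e
  ...   | yes a<e = some (here refl) λ
    { (here refl) → ≤-refl
    ; (there b∈) → ≤-trans (a-max b∈) (<⇒≤ a<e) }
  ...   | no a≮e = some (there a∈) λ { (here refl) → ≮⇒≥ a≮e ; (there b∈) → a-max b∈ }

  Larger-largest⁻ : ∀ as bs → Larger G σ (largest G σ as) (largest G σ bs) →
    Σ (Fin m) λ a → a ∈ₗ as × (∀ {b} → b ∈ₗ bs → σ b < σ a)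
  Larger-largest⁻ as bs larger
    with largest G σ as | largest-correct as | largest G σ bs | largest-correct bs
  ... | nothing | none | _ | _ = ⊥-elim larger
  ... | just a | some a∈ _ | nothing | none = a , a∈ , λ ()
  ... | just a | some a∈ _ | just b | some _ b-max = a , a∈ , λ b′∈ → ≤-<-trans (b-max b′∈) larger

  Larger-largest⁺ : ∀ {a} as bs → a ∈ₗ as → (∀ {b} → b ∈ₗ bs → σ b < σ a) →
    Larger G σ (largest G σ as) (largest G σ bs)
  Larger-largest⁺ as bs a∈ a-larger
    with largest G σ as | largest-correct as | largest G σ bs | largest-correct bs
  ... | nothing | none | _ | _ with a∈
  ...   | ()
  Larger-largest⁺ as bs a∈ a-larger | just _ | some _ _ | nothing | none = tt
  Larger-largest⁺ as bs a∈ a-larger | just _ | some _ a′-max | just _ | some b∈ _ =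
    <-≤-trans (a-larger b∈) (a′-max a∈)

  ∈-prefixEdges⁻ : (L : List (Fin n)) (w : Walk G S x y) → f ∈ₗ prefixEdges G σ L w →
    f ∈ₗ edges G w × (src f ∉ₗ L ⊎ tgt f ∉ₗ L)
  ∈-prefixEdges⁻ {x = x} L (step e p jn w) f∈ with any? (x ≟_) L
  ∈-prefixEdges⁻ L (step e p jn w) () | yes _
  ∈-prefixEdges⁻ L (step e p jn w) (here refl) | no x∉L with Joins-start jn
  ... | inj₁ refl = here refl , inj₁ x∉L
  ... | inj₂ refl = here refl , inj₂ x∉L
  ∈-prefixEdges⁻ L (step e p jn w) (there f∈) | no x∉L with ∈-prefixEdges⁻ L w f∈
  ... | f∈w , outside = there f∈w , outside

module SpanningTree (G : Graph) {T : Subset (Graph.m G)} (spanning : IsSpanningTree G T) where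
  open Graph G
  open Walks G

  private variable
    f : Fin m
    i j x y : Fin n

  acyclic : ∀ x (w : Walk G T x x) → ¬ IsCycle G w
  acyclic = proj₂ spanning

  path-unique : (A B : Walk G T x y) → IsPath G A → IsPath G B →
    edges G A ≡ edges G B × vertices G A ≡ vertices G B
  path-unique [] [] _ _ = refl , refl
  path-unique [] (step _ _ _ B) _ pB = ⊥-elim (head∉ pB (end∈ B))
  path-unique (step _ _ _ A) [] pA _ = ⊥-elim (head∉ pA (end∈ A))
  path-unique {x = x} (step e p jn A) (step e′ p′ jn′ B) pA pB with e ≟ e′
  ... | yes refl with Joins-functional jn jn′
  ...   | refl with path-unique A B (unique-tail pA) (unique-tail pB)
  ...     | same-edges , same-vertices = cong (e ∷_) same-edges , cong (x ∷_) same-vertices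
  path-unique {x = x} (step e p jn A) (step e′ p′ jn′ B) pA pB | no e≢e′ =
    ⊥-elim (acyclic _ (step e p (Joins-sym jn) W) (close-cycle p (Joins-sym jn) W (detour-path M) e∉W))
    where
    M = meet A (step e′ p′ jn′ B) (unique-tail pA) pB
    W = detour M
    e∉W : e ∉ₗ edges G W
    e∉W e∈W with detour-edges M e∈W
    ... | inj₁ e∈A = Joins-∉edges jn A (head∉ pA) e∈A
    ... | inj₂ (here e≡e′) = e≢e′ e≡e′
    ... | inj₂ (there e∈B) = Joins-∉edges jn B (head∉ pB) e∈B

  -- In a tree X and Y coincide from the meeting vertex onwards.
  detour-separates : {X : Walk G T i y} {Y : Walk G T j y} (M : Meeting X Y) →
    IsPath G X → IsPath G Y → f ∈ₗ edges G (detour M) →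
    (f ∈ₗ edges G X × f ∉ₗ edges G Y) ⊎ (f ∈ₗ edges G Y × f ∉ₗ edges G X)
  detour-separates {f = f} (meeting X₁ X₂ Y₁ Y₂ X₁-avoids-Y _) pX pY f∈
    with ∈-edges-++ʷ⁻ Y₁ (reverse X₁) f∈
  ... | inj₂ f∈rX₁ = inj₁ (∈-edges-++ʷˡ X₁ X₂ f∈X₁ , X₁-avoids-Y f∈X₁)
    where f∈X₁ = ∈-edges-reverse⁻ X₁ f∈rX₁
  ... | inj₁ f∈Y₁ = inj₂ (∈-edges-++ʷˡ Y₁ Y₂ f∈Y₁ , f∉X)
    where
    f∉X : f ∉ₗ edges G (X₁ ++ʷ X₂)
    f∉X f∈X with ∈-edges-++ʷ⁻ X₁ X₂ f∈X
    ... | inj₁ f∈X₁ = X₁-avoids-Y f∈X₁ (∈-edges-++ʷˡ Y₁ Y₂ f∈Y₁)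
    ... | inj₂ f∈X₂ = path-edges-disjoint Y₁ Y₂ pY f∈Y₁ (subst (_ ∈ₗ_) same-tail f∈X₂)
      where
      same-tail : edges G X₂ ≡ edges G Y₂
      same-tail = proj₁ (path-unique X₂ Y₂ (suffix-path X₁ X₂ pX) (suffix-path Y₁ Y₂ pY))

  not-mutually-on-paths : (Qi : Walk G T i y) (Qj : Walk G T j y) → IsPath G Qi → IsPath G Qj →
    i ≢ j → i ∈ₗ vertices G Qj → j ∉ₗ vertices G Qi
  not-mutually-on-paths Qi Qj pi pj i≢j i∈Qj j∈Qi with cut Qj i∈Qj
  ... | A , B , refl with path-++ʷ⁻ A B pj
  ...   | _ , pB , junction =
    i≢j (sym (junction (start∈ A) (subst (_ ∈ₗ_) (sym (proj₂ (path-unique B Qi pB pi))) j∈Qi)))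

  module _ (σ : Fin m → ℕ) where

    ∈-prefixEdges⁺ : (w : Walk G T x y) (Q : Walk G T i y) → IsPath G w → IsPath G Q →
      f ∈ₗ edges G w → f ∉ₗ edges G Q → f ∈ₗ prefixEdges G σ (vertices G Q) w
    ∈-prefixEdges⁺ {x = x} (step e p jn w) Q pw pQ f∈ f∉Q with any? (x ≟_) (vertices G Q)
    ... | yes x∈Q with cut Q x∈Q
    ...   | A , B , refl = ⊥-elim (f∉Q (∈-edges-++ʷʳ A B (subst (_ ∈ₗ_) same-edges f∈)))
      where
      same-edges : edges G (step e p jn w) ≡ edges G B
      same-edges = proj₁ (path-unique (step e p jn w) B pw (suffix-path A B pQ))
    ∈-prefixEdges⁺ (step e p jn w) Q pw pQ (here refl) f∉Q | no _ = here refl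
    ∈-prefixEdges⁺ (step e p jn w) Q pw pQ (there f∈) f∉Q | no _ =
      there (∈-prefixEdges⁺ w Q (unique-tail pw) pQ f∈ f∉Q)

module RootedTree (G : Graph) {T : Subset (Graph.m G)} (spanning : IsSpanningTree G T)
                  (q : Fin (Graph.n G)) (σ : Fin (Graph.m G) → ℕ) where
  open Graph G
  open Walks G
  open Ranking G σ
  open SpanningTree G spanning

  private variable
    e f g : Fin m
    i j x y : Fin n

  P : ∀ x → Walk G T x q
  P x = proj₁ (loop-erase (proj₁ spanning x q))

  P-path : ∀ x → IsPath G (P x)
  P-path x = proj₂ (loop-erase (proj₁ spanning x q))

  infix 4 _∈ₚ_ _∉ₚ_ _∈ₚ_∖_

  _∈ₚ_ : Fin m → Fin n → Set
  f ∈ₚ x = f ∈ₗ edges G (P x)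

  _∉ₚ_ : Fin m → Fin n → Set
  f ∉ₚ x = ¬ f ∈ₚ x

  _∈ₚ_∖_ : Fin m → Fin n → Fin n → Set
  f ∈ₚ i ∖ j = f ∈ₚ i × f ∉ₚ j

  edges-P : (Q : Walk G T x q) → IsPath G Q → edges G Q ≡ edges G (P x)
  edges-P {x} Q pQ = proj₁ (path-unique Q (P x) pQ (P-path x))

  ∈ₚ⇒∈ : f ∈ₚ x → f ∈ T
  ∈ₚ⇒∈ {x = x} = ∈-edges⇒∈ (P x)

  record Parent (e : Fin m) (i j : Fin n) : Set where
    field
      P-step : edges G (P i) ≡ e ∷ edges G (P j)
      fresh : e ∉ₚ j

  module _ (par : Parent e i j) where
    open Parent par

    parent-∈ₚ : e ∈ₚ i
    parent-∈ₚ = subst (_ ∈ₗ_) (sym P-step) (here refl)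

    ∈ₚ-parent⁺ : f ∈ₚ j → f ∈ₚ i
    ∈ₚ-parent⁺ f∈ = subst (_ ∈ₗ_) (sym P-step) (there f∈)

    ∈ₚ-parent⁻ : f ∈ₚ i → f ≡ e ⊎ f ∈ₚ j
    ∈ₚ-parent⁻ f∈ with subst (_ ∈ₗ_) P-step f∈
    ... | here f≡e = inj₁ f≡e
    ... | there f∈j = inj₂ f∈j

  path-parent : (jn : Joins G e i j) (p : e ∈ T) (w : Walk G T j q) → IsPath G (step e p jn w) → Parent e i j
  path-parent {j = j} jn p w pw = record
    { P-step = trans (sym (edges-P (step _ p jn w) pw)) (cong (_ ∷_) (edges-P w (unique-tail pw)))
    ; fresh = λ e∈j →
        Joins-∉edges jn w (head∉ pw) (subst (_ ∈ₗ_) (sym (edges-P w (unique-tail pw))) e∈j)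
    }

  tree-edge-parent : e ∈ T → Joins G e i j → Parent e i j ⊎ Parent e j i
  tree-edge-parent {i = i} {j} p jn with any? (i ≟_) (vertices G (P j)) | any? (j ≟_) (vertices G (P i))
  ... | no i∉Pj | _ = inj₁ (path-parent jn p (P j) (i∉Pj ∷ᵘ P-path j))
  ... | yes _ | no j∉Pi = inj₂ (path-parent (Joins-sym jn) p (P i) (j∉Pi ∷ᵘ P-path i))
  ... | yes i∈Pj | yes j∈Pi =
    ⊥-elim (not-mutually-on-paths (P i) (P j) (P-path i) (P-path j)
             (λ { refl → Joins-irrefl jn }) i∈Pj j∈Pi)

  tree-edge-on-path : e ∈ T → Σ (Fin n) (e ∈ₚ_)
  tree-edge-on-path p with tree-edge-parent p (inj₁ (refl , refl))
  ... | inj₁ par = _ , parent-∈ₚ par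
  ... | inj₂ par = _ , parent-∈ₚ par

  ∈-prefixEdges⇒∈ₚ∖ : (Qi : Walk G T i q) (Qj : Walk G T j q) → IsPath G Qi → IsPath G Qj →
    f ∈ₗ prefixEdges G σ (vertices G Qj) Qi → f ∈ₚ i ∖ j
  ∈-prefixEdges⇒∈ₚ∖ Qi Qj pi pj f∈ with ∈-prefixEdges⁻ (vertices G Qj) Qi f∈
  ... | f∈Qi , outside =
    subst (_ ∈ₗ_) (edges-P Qi pi) f∈Qi ,
    λ f∈Pj → endpoint∉⇒∉edges Qj outside (subst (_ ∈ₗ_) (sym (edges-P Qj pj)) f∈Pj)

  ∈ₚ∖⇒∈-prefixEdges : (Qi : Walk G T i q) (Qj : Walk G T j q) → IsPath G Qi → IsPath G Qj →
    f ∈ₚ i ∖ j → f ∈ₗ prefixEdges G σ (vertices G Qj) Qi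
  ∈ₚ∖⇒∈-prefixEdges Qi Qj pi pj (f∈i , f∉j) =
    ∈-prefixEdges⁺ σ Qi Qj pi pj (subst (_ ∈ₗ_) (sym (edges-P Qi pi)) f∈i)
      λ f∈Qj → f∉j (subst (_ ∈ₗ_) (edges-P Qj pj) f∈Qj)

  -- The edges of P_i before meet(i, j) are exactly those of P_i ∖ P_j, so e_ij is the
  -- largest edge of P_i ∖ P_j, and i ≻ j says that it beats every edge of P_j ∖ P_i.
  record Dominates (i j : Fin n) : Set where
    constructor dominates
    field
      edge : Fin m
      edge-∈ : edge ∈ₚ i ∖ j
      edge-larger : ∀ {g} → g ∈ₚ j ∖ i → σ g < σ edge

  Succ⇒Dominates : Succ G σ q T i j → Dominates i j
  Succ⇒Dominates (Qi , Qj , pi , pj , larger) with Larger-largest⁻ _ _ larger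
  ... | a , a∈ , a-larger =
    dominates a (∈-prefixEdges⇒∈ₚ∖ Qi Qj pi pj a∈)
      λ g∈ → a-larger (∈ₚ∖⇒∈-prefixEdges Qj Qi pj pi g∈)

  Dominates⇒Succ : Dominates i j → Succ G σ q T i j
  Dominates⇒Succ {i} {j} (dominates a a∈ a-larger) =
    P i , P j , P-path i , P-path j ,
    Larger-largest⁺ _ _ (∈ₚ∖⇒∈-prefixEdges (P i) (P j) (P-path i) (P-path j) a∈)
      λ b∈ → a-larger (∈-prefixEdges⇒∈ₚ∖ (P j) (P i) (P-path j) (P-path i) b∈)

  parent-dominates : Parent e i j → Dominates i j
  parent-dominates par = dominates _ (parent-∈ₚ par , Parent.fresh par)
    λ (g∈j , g∉i) → ⊥-elim (g∉i (∈ₚ-parent⁺ par g∈j))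

  Separates : Fin m → Fin n → Fin n → Set
  Separates g i j = g ∈ₚ i ∖ j ⊎ g ∈ₚ j ∖ i

  Separator≥ : Fin m → Fin n → Fin n → Set
  Separator≥ e i j = Σ (Fin m) λ g → Separates g i j × σ e ≤ σ g

  -- Safety applied to the fundamental cycle of e: e followed by the detour between P_j and P_i.
  non-tree-separator : Safe G σ T → e ∉ T → Joins G e i j → Separator≥ e i j
  non-tree-separator {e} {i} {j} safe e∉T jn = larger-on-detour (find (safe e e∉T i cycle is-cycle))
    where
    M = meet (P i) (P j) (P-path i) (P-path j)
    e∈T+e = x∈p∪q⁺ (inj₂ (x∈⁅x⁆ e))
    W = weaken (p⊆p∪q ⁅ e ⁆) (detour M)
    cycle = step e e∈T+e jn W
    edges-W : edges G W ≡ edges G (detour M)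
    edges-W = edges-weaken _ (detour M)
    is-cycle : IsCycle G cycle
    is-cycle = close-cycle e∈T+e jn W
      (subst Unique (sym (vertices-weaken _ (detour M))) (detour-path M))
      λ e∈W → e∉T (∈-edges⇒∈ (detour M) (subst (_ ∈ₗ_) edges-W e∈W))
    larger-on-detour : Σ (Fin m) (λ g → g ∈ₗ edges G cycle × σ e < σ g) → Separator≥ e i j
    larger-on-detour (_ , here refl , e<e) = ⊥-elim (<-irrefl refl e<e)
    larger-on-detour (g , there g∈W , e<g) =
      g , detour-separates M (P-path i) (P-path j) (subst (_ ∈ₗ_) edges-W g∈W) , <⇒≤ e<g

  separator : Safe G σ T → Joins G e i j → Separator≥ e i j
  separator {e} safe jn with e ∈? T
  ... | no e∉T = non-tree-separator safe e∉T jn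
  ... | yes e∈T with tree-edge-parent e∈T jn
  ...   | inj₁ par = e , inj₁ (parent-∈ₚ par , Parent.fresh par) , ≤-refl
  ...   | inj₂ par = e , inj₂ (parent-∈ₚ par , Parent.fresh par) , ≤-refl

module Comparison (G : Graph) (σ : Fin (Graph.m G) → ℕ) (σ-injective : Injective _≡_ _≡_ σ)
                  (q : Fin (Graph.n G)) {TA TB : Subset (Graph.m G)}
                  (spanningA : IsSpanningTree G TA) (spanningB : IsSpanningTree G TB) (safeB : Safe G σ TB)
                  (μA⊆μB : ∀ i j → μ G σ q TA i j → μ G σ q TB i j) where
  open Graph G
  open Walks G
  module A = RootedTree G spanningA q σ
  module B = RootedTree G spanningB q σ

  AgreeAbove : Fin m → Set
  AgreeAbove h = ∀ {g} → σ h < σ g → ∀ x → (g A.∈ₚ x → g B.∈ₚ x) × (g B.∈ₚ x → g A.∈ₚ x)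

  module ParentStep {h g x p} (agree : AgreeAbove h) (jn : Joins G g x p) (parent : A.Parent g x p) where

    B-dominates : B.Dominates x p
    B-dominates with μA⊆μB x p (g , jn , A.Dominates⇒Succ (A.parent-dominates parent))
    ... | _ , _ , succ = B.Succ⇒Dominates succ

    open B.Dominates B-dominates public renaming (edge to f; edge-∈ to f∈x∖p; edge-larger to f-larger)

    B-diff-is-parent : ∀ {g′} → σ h < σ g′ → g′ B.∈ₚ x ∖ p → g′ ≡ g
    B-diff-is-parent h<g′ (g′∈x , g′∉p) with A.∈ₚ-parent⁻ parent (proj₂ (agree h<g′ x) g′∈x)
    ... | inj₁ g′≡g = g′≡g
    ... | inj₂ g′∈Ap = ⊥-elim (g′∉p (proj₁ (agree h<g′ p) g′∈Ap))

    no-B-reverse-diff : ∀ {g′} → σ h < σ g′ → ¬ g′ B.∈ₚ p ∖ x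
    no-B-reverse-diff h<g′ (g′∈p , g′∉x) =
      g′∉x (proj₁ (agree h<g′ x) (A.∈ₚ-parent⁺ parent (proj₂ (agree h<g′ p) g′∈p)))

    inherited-from-parent : h B.∈ₚ p → h B.∈ₚ x
    inherited-from-parent h∈p with any? (h ≟_) (edges G (B.P x))
    ... | yes h∈x = h∈x
    ... | no h∉x = by-B-parent (B.tree-edge-parent (subst (_∈ TB) f≡g (B.∈ₚ⇒∈ (proj₁ f∈x∖p))) jn)
      where
      f≡g : f ≡ g
      f≡g = B-diff-is-parent (f-larger (h∈p , h∉x)) f∈x∖p
      by-B-parent : B.Parent g x p ⊎ B.Parent g p x → h B.∈ₚ x
      by-B-parent (inj₁ par) = B.∈ₚ-parent⁺ par h∈p
      by-B-parent (inj₂ par) = ⊥-elim (proj₂ f∈x∖p (subst (B._∈ₚ p) (sym f≡g) (B.parent-∈ₚ par)))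

  parent-edge-transfers : ∀ {g x p} → AgreeAbove g → Joins G g x p → A.Parent g x p → g B.∈ₚ x
  parent-edge-transfers {g} {x} {p} agree jn parent = by-separator (B.separator safeB jn)
    where
    open ParentStep agree jn parent
    by-separator : B.Separator≥ g x p → g B.∈ₚ x
    by-separator (g′ , separates , g≤g′) with m≤n⇒m<n∨m≡n g≤g′ | separates
    ... | inj₁ g<g′ | inj₁ diff = ⊥-elim (<-irrefl (cong σ (sym (B-diff-is-parent g<g′ diff))) g<g′)
    ... | inj₁ g<g′ | inj₂ diff = ⊥-elim (no-B-reverse-diff g<g′ diff)
    ... | inj₂ σg≡σg′ | _ with σ-injective σg≡σg′
    ...   | refl with separates
    ...     | inj₁ (g∈x , _) = g∈x
    ...     | inj₂ diff = ⊥-elim (<-irrefl (cong σ (sym (B-diff-is-parent g<f f∈x∖p))) g<f)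
      where
      g<f : σ g < σ f
      g<f = f-larger diff

  transfer : ∀ {h x} → AgreeAbove h → (w : Walk G TA x q) → IsPath G w → h ∈ₗ edges G w → h B.∈ₚ x
  transfer agree (step g g∈TA jn w) pw (here refl) =
    parent-edge-transfers agree jn (A.path-parent jn g∈TA w pw)
  transfer agree (step g g∈TA jn w) pw (there h∈w) =
    ParentStep.inherited-from-parent agree jn (A.path-parent jn g∈TA w pw) (transfer agree w (unique-tail pw) h∈w)

same-orientation⇒same-tree : (G : Graph) (q : Fin (Graph.n G))
  (σ : Fin (Graph.m G) → ℕ) → Injective _≡_ _≡_ σ → {T₁ T₂ : Subset (Graph.m G)} →
  IsSpanningTree G T₁ → IsSpanningTree G T₂ → Safe G σ T₁ → Safe G σ T₂ →
  SameOrientation G (μ G σ q T₁) (μ G σ q T₂) → T₁ ≡ T₂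
same-orientation⇒same-tree G q σ σ-injective {T₁} {T₂} spanning₁ spanning₂ safe₁ safe₂ same =
  ⊆-antisym T₁⊆T₂ T₂⊆T₁
  where
  open Graph G
  module T₁ = RootedTree G spanning₁ q σ
  module T₂ = RootedTree G spanning₂ q σ
  module C₁₂ = Comparison G σ σ-injective q spanning₁ spanning₂ safe₂ (λ i j → Equivalence.to (same i j))
  module C₂₁ = Comparison G σ σ-injective q spanning₂ spanning₁ safe₁ (λ i j → Equivalence.from (same i j))

  Agree : Fin m → Set
  Agree h = ∀ x → (h T₁.∈ₚ x → h T₂.∈ₚ x) × (h T₂.∈ₚ x → h T₁.∈ₚ x)

  same-paths : ∀ h → Agree h
  same-paths = downward-induction σ Agree λ h agree x →
    C₁₂.transfer agree (T₁.P x) (T₁.P-path x) ,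
    C₂₁.transfer (λ h<g y → swap (agree h<g y)) (T₂.P x) (T₂.P-path x)

  T₁⊆T₂ : T₁ ⊆ T₂
  T₁⊆T₂ h∈T₁ with T₁.tree-edge-on-path h∈T₁
  ... | x , h∈x = T₂.∈ₚ⇒∈ (proj₁ (same-paths _ x) h∈x)

  T₂⊆T₁ : T₂ ⊆ T₁
  T₂⊆T₁ h∈T₂ with T₂.tree-edge-on-path h∈T₂
  ... | x , h∈x = T₁.∈ₚ⇒∈ (proj₂ (same-paths _ x) h∈x)

mainTheorem6 : (G : Graph) → Connected G → (q : Fin (Graph.n G)) →
    (σ : Fin (Graph.m G) → ℕ) → Injective _≡_ _≡_ σ →
    (T₁ T₂ : Subset (Graph.m G)) →
    IsSpanningTree G T₁ → IsSpanningTree G T₂ →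
    Safe G σ T₁ → Safe G σ T₂ → T₁ ≢ T₂ →
    ¬ SameOrientation G (μ G σ q T₁) (μ G σ q T₂)
mainTheorem6 G _ q σ σ-injective T₁ T₂ spanning₁ spanning₂ safe₁ safe₂ T₁≢T₂ same =
  T₁≢T₂ (same-orientation⇒same-tree G q σ σ-injective spanning₁ spanning₂ safe₁ safe₂ same)
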